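{- Let $A$ be a quantifier-free symbolic heap of array separation logic and $s$ a stack. Then there exists a heap $h$ with $s,h\models A$ if and only if there exists a heap $h'$ with $s,h'\models \lfloor A\rfloor$.
   Context: Array separation logic (ASL). Terms: $t ::= x \mid n \mid t+t \mid n\,t$ ($x$ a variable, $n\in\mathbb{N}$). Pure formulas $\Pi$: finite conjunctions of $t=t$, $t\neq t$, $t\le t$, $t<t$. Spatial formulas: $F ::= \mathsf{emp} \mid t\mapsto t \mid \mathsf{array}(t,t) \mid F * F$. A quantifier-free symbolic heap is $\Pi : F$. Stacks $s:\mathsf{Var}\to\mathbb{N}$ (extended to terms homomorphically); heaps are finite partial functions $\mathbb{N}\rightharpoonup\mathbb{N}$, with $h_1\circ h_2$ the union of domain-disjoint heaps. Satisfaction: $s,h\models t_1\sim t_2$ iff $s(t_1)\sim s(t_2)$; $s,h\models\mathsf{emp}$ iff $\mathrm{dom}(h)=\emptyset$; $s,h\models t_1\mapsto t_2$ iff $\mathrm{dom}(h)=\{s(t_1)\}$ and $h(s(t_1))=s(t_2)$; $s,h\models\mathsf{array}(t_1,t_2)$ iff $s(t_1)\le s(t_2)$ and $\mathrm{dom}(h)=\{s(t_1),\dots,s(t_2)\}$; $s,h\models F_1*F_2$ iff $h=h_1\circ h_2$ with $s,h_i\models F_i$; $s,h\models\Pi:F$ iff $s,h\models\Pi$ and $s,h\models F$. Array abstraction: if $A = \Pi : \mathop{*}_{i=1}^n\mathsf{array}(a_i,b_i) * \mathop{*}_{i=1}^m c_i\mapsto d_i$, then $\lfloor A\rfloor = \Pi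 : \mathop{*}_{i=1}^n\mathsf{array}(a_i,b_i) * \mathop{*}_{i=1}^m \mathsf{array}(c_i,c_i)$. -}

module Defs where

open import Data.Nat using (ℕ; _+_; _*_; _≤_; _<_)
open import Data.Maybe using (Maybe; just; nothing)
open import Data.Product using (Σ; ∃; _×_; _,_)
open import Data.List using (List)
open import Data.List.Relation.Unary.All using (All)
open import Data.Empty using (⊥)
open import Relation.Binary.PropositionalEquality using (_≡_; _≢_)
open import Relation.Nullary using (¬_)
open import Function.Bundles using (_⇔_)

Var : Set
Var = ℕ

Stack : Set
Stack = Var → ℕ

data Term : Set where
  var  : Var → Term
  num  : ℕ → Term
  _⊕_  : Term → Term → Term
  _⊛_  : ℕ → Term → Term

⟦_⟧ : Term → Stack → ℕ
⟦ var x ⟧ s = s x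
⟦ num n ⟧ s = n
⟦ t ⊕ u ⟧ s = ⟦ t ⟧ s + ⟦ u ⟧ s
⟦ n ⊛ t ⟧ s = n * ⟦ t ⟧ s

data PureAtom : Set where
  _=ₚ_ _≠ₚ_ _≤ₚ_ _<ₚ_ : Term → Term → PureAtom

Pure : Set
Pure = List PureAtom

data Spatial : Set where
  emp   : Spatial
  _↦_   : Term → Term → Spatial
  array : Term → Term → Spatial
  _✶_   : Spatial → Spatial → Spatial

record SymHeap : Set where
  constructor _∶_
  field
    pure    : Pure
    spatial : Spatial

record Heap : Set where
  field
    fun    : ℕ → Maybe ℕ
    bound  : ℕ
    finite : ∀ x → bound ≤ x → fun x ≡ nothing
open Heap public

_∈dom_ : ℕ → Heap → Set
x ∈dom h = ∃ λ v → fun h x ≡ just v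

union : Maybe ℕ → Maybe ℕ → Maybe ℕ
union (just v) _ = just v
union nothing  m = m

_≡_∘_ : Heap → Heap → Heap → Set
h ≡ h₁ ∘ h₂ =
  (∀ x → ¬ (x ∈dom h₁ × x ∈dom h₂)) ×
  (∀ x → fun h x ≡ union (fun h₁ x) (fun h₂ x))

_⊨ₐ_ : Stack → PureAtom → Set
s ⊨ₐ (t =ₚ u) = ⟦ t ⟧ s ≡ ⟦ u ⟧ s
s ⊨ₐ (t ≠ₚ u) = ⟦ t ⟧ s ≢ ⟦ u ⟧ s
s ⊨ₐ (t ≤ₚ u) = ⟦ t ⟧ s ≤ ⟦ u ⟧ s
s ⊨ₐ (t <ₚ u) = ⟦ t ⟧ s < ⟦ u ⟧ s

_⊨ₚ_ : Stack → Pure → Set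
s ⊨ₚ Π = All (s ⊨ₐ_) Π

_,_⊨ₛ_ : Stack → Heap → Spatial → Set
s , h ⊨ₛ emp = ∀ x → ¬ (x ∈dom h)
s , h ⊨ₛ (t ↦ u) =
  (∀ x → (x ∈dom h) ⇔ (x ≡ ⟦ t ⟧ s)) × (fun h (⟦ t ⟧ s) ≡ just (⟦ u ⟧ s))
s , h ⊨ₛ array t u =
  (⟦ t ⟧ s ≤ ⟦ u ⟧ s) ×
  (∀ x → (x ∈dom h) ⇔ (⟦ t ⟧ s ≤ x × x ≤ ⟦ u ⟧ s))
s , h ⊨ₛ (F ✶ G) =
  Σ Heap λ h₁ → Σ Heap λ h₂ → (h ≡ h₁ ∘ h₂) × (s , h₁ ⊨ₛ F) × (s , h₂ ⊨ₛ G)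

_,_⊨_ : Stack → Heap → SymHeap → Set
s , h ⊨ (Π ∶ F) = (s ⊨ₚ Π) × (s , h ⊨ₛ F)

⌊_⌋ₛ : Spatial → Spatial
⌊ emp ⌋ₛ = emp
⌊ t ↦ u ⌋ₛ = array t t
⌊ array t u ⌋ₛ = array t u
⌊ F ✶ G ⌋ₛ = ⌊ F ⌋ₛ ✶ ⌊ G ⌋ₛ

⌊_⌋ : SymHeap → SymHeap
⌊ Π ∶ F ⌋ = Π ∶ ⌊ F ⌋ₛ

-- Array abstraction only forgets the contents of the points-to cells, and
-- t ↦ u and array(t,t) constrain the domain in the same way.  So a model of A
-- is already a model of ⌊A⌋.  Conversely, since separating conjunction only
-- constrains domains, a model of ⌊A⌋ can be rebuilt, cell by cell, into a model
-- of A with the same domain: each array(t,t) coming from t ↦ u is replaced by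
-- the singleton heap storing u at t.
module Submission where

open import Defs
open import Data.Empty using (⊥-elim)
open import Data.Maybe using (Maybe; just; nothing)
open import Data.Nat using (ℕ; suc; _≤_; _⊔_; _≟_)
open import Data.Nat.Properties using (≤-refl; ≤-antisym; <⇒≢; m⊔n≤o⇒m≤o; m⊔n≤o⇒n≤o)
open import Data.Product using (∃; Σ; _×_; _,_)
open import Data.Sum using (_⊎_; inj₁; inj₂)
open import Data.Sum.Function.Propositional using (_⊎-⇔_)
open import Function.Bundles using (_⇔_; mk⇔; Equivalence)
open import Function.Properties.Equivalence using (⇔-isEquivalence)
open import Level using (0ℓ)
open import Relation.Nullary using (¬_; yes; no)
open import Relation.Binary.Structures using (IsEquivalence)
open import Relation.Binary.PropositionalEquality using (_≡_; refl; sym; cong₂)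

module ⇔ = IsEquivalence (⇔-isEquivalence {0ℓ})

≡⇔≤×≥ : ∀ {x a : ℕ} → (x ≡ a) ⇔ (a ≤ x × x ≤ a)
≡⇔≤×≥ = mk⇔ (λ { refl → ≤-refl , ≤-refl }) (λ (a≤x , x≤a) → ≤-antisym x≤a a≤x)

record _≈dom_ (h g : Heap) : Set where
  constructor mk≈dom
  field ∈dom⇔ : ∀ x → (x ∈dom h) ⇔ (x ∈dom g)
open _≈dom_

Disjoint : Heap → Heap → Set
Disjoint h₁ h₂ = ∀ x → ¬ (x ∈dom h₁ × x ∈dom h₂)

Disjoint-resp-≈dom : ∀ {h₁ h₂ g₁ g₂} → h₁ ≈dom g₁ → h₂ ≈dom g₂ →
  Disjoint g₁ g₂ → Disjoint h₁ h₂
Disjoint-resp-≈dom h₁≈g₁ h₂≈g₂ g₁#g₂ x (x∈h₁ , x∈h₂) =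
  g₁#g₂ x (Equivalence.to (∈dom⇔ h₁≈g₁ x) x∈h₁ , Equivalence.to (∈dom⇔ h₂≈g₂ x) x∈h₂)

union-just⇔ : (m₁ m₂ : Maybe ℕ) →
  (∃ λ v → union m₁ m₂ ≡ just v) ⇔ ((∃ λ v → m₁ ≡ just v) ⊎ (∃ λ v → m₂ ≡ just v))
union-just⇔ (just v) m₂ = mk⇔ (λ _ → inj₁ (v , refl)) (λ _ → v , refl)
union-just⇔ nothing  m₂ = mk⇔ inj₂ (λ { (inj₁ (_ , ())) ; (inj₂ m₂≡v) → m₂≡v })

∘⇒∈dom⇔⊎ : ∀ h h₁ h₂ → h ≡ h₁ ∘ h₂ →
  ∀ x → (x ∈dom h) ⇔ (x ∈dom h₁ ⊎ x ∈dom h₂)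
∘⇒∈dom⇔⊎ _ h₁ h₂ (_ , fun≡) x rewrite fun≡ x = union-just⇔ (fun h₁ x) (fun h₂ x)

∘-resp-≈dom : ∀ {h h₁ h₂ g g₁ g₂} → h ≡ h₁ ∘ h₂ → g ≡ g₁ ∘ g₂ →
  h₁ ≈dom g₁ → h₂ ≈dom g₂ → h ≈dom g
∘-resp-≈dom {h} {h₁} {h₂} {g} {g₁} {g₂} h≡h₁∘h₂ g≡g₁∘g₂ h₁≈g₁ h₂≈g₂ = mk≈dom λ x →
  ⇔.trans (∘⇒∈dom⇔⊎ h h₁ h₂ h≡h₁∘h₂ x)
    (⇔.trans (∈dom⇔ h₁≈g₁ x ⊎-⇔ ∈dom⇔ h₂≈g₂ x) (⇔.sym (∘⇒∈dom⇔⊎ g g₁ g₂ g≡g₁∘g₂ x)))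

_∪_ : Heap → Heap → Heap
h₁ ∪ h₂ = record
  { fun    = λ x → union (fun h₁ x) (fun h₂ x)
  ; bound  = bound h₁ ⊔ bound h₂
  ; finite = λ x bound≤x → cong₂ union
      (finite h₁ x (m⊔n≤o⇒m≤o (bound h₁) (bound h₂) bound≤x))
      (finite h₂ x (m⊔n≤o⇒n≤o (bound h₁) (bound h₂) bound≤x))
  }

∪-∘ : ∀ h₁ h₂ → Disjoint h₁ h₂ → (h₁ ∪ h₂) ≡ h₁ ∘ h₂
∪-∘ _ _ h₁#h₂ = h₁#h₂ , λ _ → refl

singleton : ℕ → ℕ → Heap
singleton a v = record
  { fun    = cell
  ; bound  = suc a
  ; finite = λ x a<x → cell-≢ x (λ x≡a → <⇒≢ a<x (sym x≡a))
  }
  where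
  cell : ℕ → Maybe ℕ
  cell x with x ≟ a
  ... | yes _ = just v
  ... | no  _ = nothing

  cell-≢ : ∀ x → ¬ x ≡ a → cell x ≡ nothing
  cell-≢ x x≢a with x ≟ a
  ... | yes x≡a = ⊥-elim (x≢a x≡a)
  ... | no  _   = refl

singleton-fun : ∀ a v → fun (singleton a v) a ≡ just v
singleton-fun a v with a ≟ a
... | yes _   = refl
... | no  a≢a = ⊥-elim (a≢a refl)

singleton-∈dom : ∀ a v x → (x ∈dom singleton a v) ⇔ (x ≡ a)
singleton-∈dom a v x = mk⇔ ∈dom⇒≡ (λ { refl → v , singleton-fun a v })
  where
  ∈dom⇒≡ : x ∈dom singleton a v → x ≡ a
  ∈dom⇒≡ _ with x ≟ a
  ∈dom⇒≡ _        | yes x≡a = x≡a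
  ∈dom⇒≡ (_ , ()) | no  _

⊨ₛ⇒⊨ₛ⌊⌋ : ∀ {s h} F → s , h ⊨ₛ F → s , h ⊨ₛ ⌊ F ⌋ₛ
⊨ₛ⇒⊨ₛ⌊⌋ emp         ⊨F = ⊨F
⊨ₛ⇒⊨ₛ⌊⌋ (t ↦ u)     (dom , _) = ≤-refl , λ x → ⇔.trans (dom x) ≡⇔≤×≥
⊨ₛ⇒⊨ₛ⌊⌋ (array t u) ⊨F = ⊨F
⊨ₛ⇒⊨ₛ⌊⌋ (F ✶ G)     (h₁ , h₂ , split , ⊨F , ⊨G) =
  h₁ , h₂ , split , ⊨ₛ⇒⊨ₛ⌊⌋ F ⊨F , ⊨ₛ⇒⊨ₛ⌊⌋ G ⊨G

⊨ₛ⌊⌋⇒⊨ₛ : ∀ {s g} F → s , g ⊨ₛ ⌊ F ⌋ₛ → Σ Heap λ h → (s , h ⊨ₛ F) × h ≈dom g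
⊨ₛ⌊⌋⇒⊨ₛ {g = g} emp ⊨F = g , ⊨F , mk≈dom λ _ → ⇔.refl
⊨ₛ⌊⌋⇒⊨ₛ {s} (t ↦ u) (_ , dom) =
  singleton (⟦ t ⟧ s) (⟦ u ⟧ s) ,
  (singleton-∈dom _ _ , singleton-fun _ _) ,
  mk≈dom λ x → ⇔.trans (singleton-∈dom _ _ x) (⇔.trans ≡⇔≤×≥ (⇔.sym (dom x)))
⊨ₛ⌊⌋⇒⊨ₛ {g = g} (array t u) ⊨F = g , ⊨F , mk≈dom λ _ → ⇔.refl
⊨ₛ⌊⌋⇒⊨ₛ (F ✶ G) (g₁ , g₂ , g≡g₁∘g₂@(g₁#g₂ , _) , ⊨F , ⊨G) =
  let (h₁ , ⊨F′ , h₁≈g₁) = ⊨ₛ⌊⌋⇒⊨ₛ F ⊨F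
      (h₂ , ⊨G′ , h₂≈g₂) = ⊨ₛ⌊⌋⇒⊨ₛ G ⊨G
      split = ∪-∘ h₁ h₂ (Disjoint-resp-≈dom h₁≈g₁ h₂≈g₂ g₁#g₂)
  in h₁ ∪ h₂ , (h₁ , h₂ , split , ⊨F′ , ⊨G′) , ∘-resp-≈dom split g≡g₁∘g₂ h₁≈g₁ h₂≈g₂

lemma11 : (A : SymHeap) (s : Stack) →
    (∃ λ h → s , h ⊨ A) ⇔ (∃ λ h′ → s , h′ ⊨ ⌊ A ⌋)
lemma11 (Π ∶ F) s = mk⇔
  (λ (h , ⊨Π , ⊨F) → h , ⊨Π , ⊨ₛ⇒⊨ₛ⌊⌋ F ⊨F)
  (λ (g , ⊨Π , ⊨F) → let (h , ⊨F′ , _) = ⊨ₛ⌊⌋⇒⊨ₛ F ⊨F in h , ⊨Π , ⊨F′)
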